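{- For all non-negative integers $n$ and $t$, the integer $\binom{3n+1}{n+t+1}\binom{2n+t}{2n}$ is divisible by $2n+1$.
   Context: Binomial coefficients $\binom{a}{b}$ with $b>a\ge 0$ are taken to be $0$. -}

module Defs where

-- With A = C(3n+1, n+t+1), A′ = C(3n+1, n+t), B = C(2n+t, 2n), B′ = C(2n+t, 2n+1), the
-- absorption identity (k+1)·C(N, k+1) = (N−k)·C(N, k) gives (2n+1)·B′ = t·B and
-- (n+t+1)·A = (2n+1−t)·A′. Hence 2n+1 divides t·AB = (2n+1)·AB′ and
-- (n+t+1)·AB = (2n+1)·A′B − t·A′B = (2n+1)·(A′B − A′B′), so it divides (n+1)·AB.
-- Since 2·(n+1) = (2n+1) + 1, it divides AB.
{-# OPTIONS --safe #-}
module Submission where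

open import Defs
open import Data.Nat using (ℕ; zero; suc; _+_; _*_)
open import Data.Nat.Properties
  using (*-identityˡ; *-identityʳ; *-zeroʳ; *-distribˡ-+; +-identityʳ; +-comm; +-cancelʳ-≡)
open import Data.Nat.Divisibility using (_∣_; ∣m+n∣m⇒∣n; m∣m*n; ∣n⇒∣m*n)
open import Data.Nat.Combinatorics using (_C_; nC1≡n; nCk+nC[k+1]≡[n+1]C[k+1])
open import Data.Nat.Tactic.RingSolver using (solve-∀; solve)
open import Data.List using (_∷_; [])
open import Relation.Binary.PropositionalEquality
  using (_≡_; refl; sym; trans; cong; cong₂; subst; module ≡-Reasoning)

[k+1]*[n+1]C[k+1]≡[n+1]*nCk : ∀ n k → suc k * (suc n C suc k) ≡ suc n * (n C k)
[k+1]*[n+1]C[k+1]≡[n+1]*nCk n zero =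
  trans (*-identityˡ _) (trans (nC1≡n (suc n)) (sym (*-identityʳ (suc n))))
[k+1]*[n+1]C[k+1]≡[n+1]*nCk zero (suc k) = *-zeroʳ (suc (suc k))
[k+1]*[n+1]C[k+1]≡[n+1]*nCk (suc n) (suc k) = begin
    suc (suc k) * (suc (suc n) C suc (suc k))
  ≡⟨ cong (suc (suc k) *_) (sym (nCk+nC[k+1]≡[n+1]C[k+1] (suc n) (suc k))) ⟩
    suc (suc k) * (x + y)
  ≡⟨ split (suc k) x y ⟩
    x + (suc k * x + suc (suc k) * y)
  ≡⟨ cong₂ (λ u v → x + (u + v)) ([k+1]*[n+1]C[k+1]≡[n+1]*nCk n k)
                                 ([k+1]*[n+1]C[k+1]≡[n+1]*nCk n (suc k)) ⟩
    x + (suc n * (n C k) + suc n * (n C suc k))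
  ≡⟨ cong (x +_) (sym (*-distribˡ-+ (suc n) (n C k) (n C suc k))) ⟩
    x + suc n * (n C k + n C suc k)
  ≡⟨ cong (λ u → x + suc n * u) (nCk+nC[k+1]≡[n+1]C[k+1] n k) ⟩
    suc (suc n) * x
  ∎
  where
  open ≡-Reasoning
  x = suc n C suc k
  y = suc n C suc (suc k)
  split : ∀ a x y → suc a * (x + y) ≡ x + (a * x + suc a * y)
  split = solve-∀

[k+1]*nC[k+1]+k*nCk≡n*nCk : ∀ n k → suc k * (n C suc k) + k * (n C k) ≡ n * (n C k)
[k+1]*nC[k+1]+k*nCk≡n*nCk zero    zero    = refl
[k+1]*nC[k+1]+k*nCk≡n*nCk zero    (suc k) = cong₂ _+_ (*-zeroʳ (suc (suc k))) (*-zeroʳ (suc k))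
[k+1]*nC[k+1]+k*nCk≡n*nCk (suc n) zero    = begin
    1 * (suc n C 1) + 0  ≡⟨ +-identityʳ _ ⟩
    1 * (suc n C 1)      ≡⟨ *-identityˡ _ ⟩
    suc n C 1            ≡⟨ nC1≡n (suc n) ⟩
    suc n                ≡⟨ *-identityʳ (suc n) ⟨
    suc n * 1            ∎
  where open ≡-Reasoning
[k+1]*nC[k+1]+k*nCk≡n*nCk (suc n) (suc k) = begin
    suc (suc k) * (suc n C suc (suc k)) + suc k * (suc n C suc k)
  ≡⟨ cong₂ _+_ ([k+1]*[n+1]C[k+1]≡[n+1]*nCk n (suc k)) ([k+1]*[n+1]C[k+1]≡[n+1]*nCk n k) ⟩
    suc n * (n C suc k) + suc n * (n C k)
  ≡⟨ *-distribˡ-+ (suc n) (n C suc k) (n C k) ⟨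
    suc n * (n C suc k + n C k)
  ≡⟨ cong (suc n *_) (trans (+-comm (n C suc k) (n C k)) (nCk+nC[k+1]≡[n+1]C[k+1] n k)) ⟩
    suc n * (suc n C suc k)
  ∎
  where open ≡-Reasoning

[k+1]*[k+t]C[k+1]≡t*[k+t]Ck : ∀ k t → (k + 1) * ((k + t) C (k + 1)) ≡ t * ((k + t) C k)
[k+1]*[k+t]C[k+1]≡t*[k+t]Ck k t = +-cancelʳ-≡ (k * c) _ _ (begin
    (k + 1) * ((k + t) C (k + 1)) + k * c  ≡⟨ cong (λ j → j * ((k + t) C j) + k * c) (+-comm k 1) ⟩
    suc k * ((k + t) C suc k) + k * c      ≡⟨ [k+1]*nC[k+1]+k*nCk≡n*nCk (k + t) k ⟩
    (k + t) * c                            ≡⟨ rearrange k t c ⟩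
    t * c + k * c                          ∎)
  where
  open ≡-Reasoning
  c = (k + t) C k
  rearrange : ∀ k t c → (k + t) * c ≡ t * c + k * c
  rearrange = solve-∀

2n+1∣[n+1]*m⇒2n+1∣m : ∀ n {m} → 2 * n + 1 ∣ (n + 1) * m → 2 * n + 1 ∣ m
2n+1∣[n+1]*m⇒2n+1∣m n {m} 2n+1∣[n+1]*m =
  ∣m+n∣m⇒∣n (subst (2 * n + 1 ∣_) (double n m) (∣n⇒∣m*n 2 2n+1∣[n+1]*m)) (m∣m*n m)
  where
  double : ∀ n m → 2 * ((n + 1) * m) ≡ (2 * n + 1) * m + m
  double = solve-∀

2n+1∣a*b : ∀ n t {a a′ b b′} →
           (2 * n + 1) * b′ ≡ t * b →
           (n + t + 1) * a + (n + t) * a′ ≡ (3 * n + 1) * a′ →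
           2 * n + 1 ∣ a * b
2n+1∣a*b n t {a} {a′} {b} {b′} b-recurrence a-recurrence =
  2n+1∣[n+1]*m⇒2n+1∣m n
    (∣m+n∣m⇒∣n (subst (2 * n + 1 ∣_) split-coefficient 2n+1∣[n+t+1]*ab) 2n+1∣t*ab)
  where
  open ≡-Reasoning

  2n+1∣t*ab : 2 * n + 1 ∣ t * (a * b)
  2n+1∣t*ab = subst (2 * n + 1 ∣_) (begin
      a * ((2 * n + 1) * b′)  ≡⟨ cong (a *_) b-recurrence ⟩
      a * (t * b)             ≡⟨ solve (t ∷ a ∷ b ∷ []) ⟩
      t * (a * b)             ∎) (∣n⇒∣m*n a (m∣m*n b′))

  cross-relation : (2 * n + 1) * (a′ * b′) + (n + t + 1) * (a * b) ≡ (2 * n + 1) * (a′ * b)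
  cross-relation = +-cancelʳ-≡ (n * (a′ * b)) _ _ (begin
      (2 * n + 1) * (a′ * b′) + (n + t + 1) * (a * b) + n * (a′ * b)
    ≡⟨ solve (n ∷ t ∷ a ∷ a′ ∷ b ∷ b′ ∷ []) ⟩
      a′ * ((2 * n + 1) * b′) + (n + t + 1) * (a * b) + n * (a′ * b)
    ≡⟨ cong (λ u → a′ * u + (n + t + 1) * (a * b) + n * (a′ * b)) b-recurrence ⟩
      a′ * (t * b) + (n + t + 1) * (a * b) + n * (a′ * b)
    ≡⟨ solve (n ∷ t ∷ a ∷ a′ ∷ b ∷ []) ⟩
      ((n + t + 1) * a + (n + t) * a′) * b
    ≡⟨ cong (_* b) a-recurrence ⟩
      (3 * n + 1) * a′ * b
    ≡⟨ solve (n ∷ a′ ∷ b ∷ []) ⟩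
      (2 * n + 1) * (a′ * b) + n * (a′ * b)
    ∎)

  2n+1∣[n+t+1]*ab : 2 * n + 1 ∣ (n + t + 1) * (a * b)
  2n+1∣[n+t+1]*ab =
    ∣m+n∣m⇒∣n (subst (2 * n + 1 ∣_) (sym cross-relation) (m∣m*n (a′ * b))) (m∣m*n (a′ * b′))

  split-coefficient : (n + t + 1) * (a * b) ≡ t * (a * b) + (n + 1) * (a * b)
  split-coefficient = solve (n ∷ t ∷ a ∷ b ∷ [])

proposition5 : ∀ (n t : ℕ) → 2 * n + 1 ∣ ((3 * n + 1) C (n + t + 1)) * ((2 * n + t) C (2 * n))
proposition5 n t = 2n+1∣a*b n t
  ([k+1]*[k+t]C[k+1]≡t*[k+t]Ck (2 * n) t)
  (subst (λ j → j * (N C j) + (n + t) * (N C (n + t)) ≡ N * (N C (n + t)))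
         (+-comm 1 (n + t))
         ([k+1]*nC[k+1]+k*nCk≡n*nCk N (n + t)))
  where N = 3 * n + 1
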